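{- Let $l\ge3$, $d\ge1$ and let $I=\{f\in W(l,d) : |f(L)|\le1\}$. Then: (i) $I$ is a prime ideal of $W(l,d)$; (ii) for regular elements $f,g\in I$ of $W(l,d)$, $f\mathcal{J}g$ if and only if $|Im(f)|=|Im(g)|$; (iii) the regular $\mathcal{J}$-classes of $W(l,d)$ contained in $I$ are precisely $J_0,\dots,J_{d+1}$; (iv) the unique maximal $\mathcal{J}$-class contained in $I$ is $J_{d+1}$.
   Context: For $l\ge3$, $d\ge1$, let $V=\{1,\dots,l+d\}$, $L=\{1,\dots,l\}$, $D=\{l+1,\dots,l+d\}$, and let $M(l,d)$ be the pairwise balanced design on $V$ whose blocks are $L$ together with all $\{i,j\}$ with $l+1\le j\le l+d$, $1\le i<j$. A subsystem is a set $F\subseteq V$ such that for all distinct $x,y\in F$ the unique block containing $x,y$ lies in $F$. For a partial function $f$, $f(A)=f(A\cap Dom(f))$, $Im(f)=f(V)$, and $f^{ -w}(B)=f^{ -1}(B)\cup(V\setminus Dom(f))$; $W(l,d)$ is the monoid (under composition of partial functions) of all partial functions $f:V\to V$ such that $f^{ -w}(F)$ is a subsystem for every subsystem $F$. An element is regular if $fgf=f$ for some $g$. Green's relation: $m\mathcal{J}n$ iff $MmM=MnM$, with $\mathcal{J}$-classes ordered by $MmM\subseteq MnM$; a $\mathcal{J}$-class is regular if it contains an idempotent. An ideal $I$ of a monoid $M$ is prime if $M\setminus I$ is a submonoid. For $0\le i\le d+1$, $J_i=\{f\in W(l,d): |Im(f)\cap L|\le1,\ |Im(f)|=i\}$. 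-}

module Defs where

open import Level using (0ℓ)
open import Data.Nat as ℕ using (ℕ; suc; _+_; _≤_; _<_)
open import Data.Fin as Fin using (Fin; toℕ)
open import Data.Fin.Subset using (Subset; _∈_; _⊆_; ⁅_⁆; _∪_; _∩_; ∣_∣; ⊤)
open import Data.Fin.Subset.Properties using (_∈?_)
open import Data.Fin.Properties using (any?)
open import Data.Maybe using (Maybe; just; nothing; _>>=_)
open import Data.Maybe.Properties using (≡-dec)
open import Data.Vec using (tabulate)
open import Data.Bool using (Bool; true)
open import Data.Product using (Σ; ∃; ∃₂; _×_; _,_)
open import Data.Sum using (_⊎_)
open import Relation.Nullary.Decidable using (⌊_⌋; _×-dec_)
open import Relation.Binary.PropositionalEquality using (_≡_; _≢_)
open import Function.Bundles using (_⇔_)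

-- Everything is parametrised by l and d; V = Fin (l + d), points are 0-based:
-- x ∈ L iff toℕ x < l, x ∈ D iff l ≤ toℕ x.
module _ (l d : ℕ) where

  V : Set
  V = Fin (l + d)

  Lset : Subset (l + d)
  Lset = tabulate (λ x → ⌊ toℕ x ℕ.<? l ⌋)

  IsBlock : Subset (l + d) → Set
  IsBlock B = B ≡ Lset
            ⊎ ∃₂ λ (i j : V) → l ≤ toℕ j × toℕ i < toℕ j × B ≡ ⁅ i ⁆ ∪ ⁅ j ⁆

  IsSubsystem : Subset (l + d) → Set
  IsSubsystem F = ∀ (x y : V) → x ≢ y → x ∈ F → y ∈ F →
                  ∀ B → IsBlock B → x ∈ B → y ∈ B → B ⊆ F

  PFun : Set
  PFun = V → Maybe V

  _·_ : PFun → PFun → PFun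
  (f · g) x = g x >>= f

  idP : PFun
  idP x = just x

  _≈_ : PFun → PFun → Set
  f ≈ g = ∀ x → f x ≡ g x

  -- f^{-w}(F) = f^{-1}(F) ∪ (V ∖ Dom f)
  private
    wB : Subset (l + d) → Maybe V → Bool
    wB F nothing  = true
    wB F (just y) = ⌊ y ∈? F ⌋

  preW : PFun → Subset (l + d) → Subset (l + d)
  preW f F = tabulate (λ x → wB F (f x))

  image : PFun → Subset (l + d) → Subset (l + d)
  image f A = tabulate (λ y → ⌊ any? (λ x → (x ∈? A) ×-dec ≡-dec Fin._≟_ (f x) (just y)) ⌋)

  Im : PFun → Subset (l + d)
  Im f = image f ⊤

  InW : PFun → Set
  InW f = ∀ F → IsSubsystem F → IsSubsystem (preW f F)

  IsRegular : PFun → Set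
  IsRegular f = InW f × ∃ λ g → InW g × ((f · g) · f) ≈ f

  IsIdempotent : PFun → Set
  IsIdempotent f = InW f × (f · f) ≈ f

  -- m ∈ W n W   (i.e. W m W ⊆ W n W, as W is a monoid)
  JLeq : PFun → PFun → Set
  JLeq m k = ∃₂ λ a b → InW a × InW b × m ≈ ((a · k) · b)

  JRel : PFun → PFun → Set
  JRel m k = JLeq m k × JLeq k m

  PSet : Set₁
  PSet = PFun → Set

  _⊆W_ : PSet → PSet → Set
  A ⊆W B = ∀ f → A f → B f

  _≐_ : PSet → PSet → Set
  A ≐ B = ∀ f → A f ⇔ B f

  IsIdeal : PSet → Set
  IsIdeal I = (I ⊆W InW)
            × (∃ λ f → I f)
            × (∀ m f → InW m → I f → I (m · f))
            × (∀ m f → InW m → I f → I (f · m))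

  -- prime ideal: W ∖ I is a submonoid
  IsPrimeIdeal : PSet → Set
  IsPrimeIdeal I = IsIdeal I
                 × (¬I idP)
                 × (∀ f g → InW f → InW g → ¬I f → ¬I g → ¬I (f · g))
    where
      ¬I : PFun → Set
      ¬I f = I f → Data.Empty.⊥
        where import Data.Empty

  IsJClass : PSet → Set
  IsJClass C = Σ PFun λ f → InW f × (C ≐ (λ g → InW g × JRel g f))

  IsRegularJClass : PSet → Set
  IsRegularJClass C = IsJClass C × ∃ λ e → C e × IsIdempotent e

  _≤J_ : PSet → PSet → Set
  C ≤J C' = ∀ m m' → C m → C' m' → JLeq m m'

  Iset : PSet
  Iset f = InW f × ∣ image f Lset ∣ ≤ 1

  Jset : ℕ → PSet
  Jset i f = InW f × ∣ Im f ∩ Lset ∣ ≤ 1 × ∣ Im f ∣ ≡ i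

  IsMaximalJClassIn : PSet → PSet → Set₁
  IsMaximalJClassIn I C = IsJClass C × (C ⊆W I)
                        × (∀ C' → IsJClass C' → C' ⊆W I → C ≤J C' → C' ≐ C)

module Submission where

-- Everything rests on two observations about the design M(l,d).  First, since the
-- pair blocks are automatic, F is a subsystem iff F ⊇ L as soon as F contains two
-- points of L ("L-closed"), so f ∈ W is a condition on f restricted to L: a map
-- constant on L whose domain meets L in all or at most one point lies in W, while an
-- element of W taking two values on L ("splitting L") is defined and injective on
-- L and, as |L| ≥ 3, maps L into L.  Second, a counting argument: a map constant
-- on L is ≤J any g whose image meets L at most once and is at least as large,
-- because one can route f through g by a partial bijection of images.

open import Defs
open import Data.Nat using (ℕ; suc; _≤_)
open import Data.Fin.Subset using (∣_∣)
open import Data.Product using (Σ; ∃; _×_)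
open import Relation.Binary.PropositionalEquality using (_≡_)
open import Function.Bundles using (_⇔_)

open import Data.Nat using (zero; _+_; _∸_; _<_; z≤n; s≤s; s≤s⁻¹; _<?_; _≤?_; >-nonZero)
import Data.Nat.Properties as ℕP
open import Data.Bool.Properties using (T-≡)
open import Data.Fin using (Fin; toℕ; fromℕ<; _≟_)
import Data.Fin.Properties as FinP
open import Data.Fin.Subset
  using (Subset; _∈_; _⊆_; ⊤; ⊥; ⁅_⁆; _∪_; _∩_; _-_; ∁; Nonempty; inside; outside)
open import Data.Fin.Subset.Properties
  using ( _∈?_; nonempty?; drop-there; ∈⊤; ∉⊥; ∣⊥∣≡0; Empty-unique; x∈⁅x⁆; x∈⁅y⁆⇒x≡y; ∣⁅x⁆∣≡1
        ; ⊆-antisym; p⊆q⇒∣p∣≤∣q∣; p⊂q⇒∣p∣<∣q∣; x∈p∩q⁺; x∈p∩q⁻; x∈p∪q⁺; x∈p∪q⁻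
        ; x∉p⇒x∈∁p; ∣∁p∣≡n∸∣p∣; p─q⊆p; x∈p∧x≢y⇒x∈p-y; x∈p⇒∣p-x∣<∣p∣ )
open import Data.Maybe using (Maybe; just; nothing; _>>=_)
open import Data.Maybe.Properties using (just-injective; ≡-dec)
open import Data.Product using (∃₂; _,_; proj₁; proj₂)
open import Data.Sum using (_⊎_; inj₁; inj₂; [_,_])
open import Data.Vec using (_∷_; []; tabulate; lookup)
open import Data.Vec.Properties using (lookup∘tabulate; lookup⇒[]=; []=⇒lookup; tabulate-cong)
open import Function.Bundles using (mk⇔; Equivalence)
open import Function.Properties.Equivalence using () renaming (sym to ⇔-sym; trans to ⇔-trans)
open import Relation.Binary.PropositionalEquality using (_≢_; refl; sym; trans; cong; subst; module ≡-Reasoning)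
open import Relation.Nullary using (Dec; yes; no; ¬_)
open import Relation.Nullary.Decidable using (⌊_⌋; _×-dec_; does-⇔; isYes≗does; toWitness; fromWitness)
open import Relation.Nullary.Negation using (contradiction)

open Equivalence using (to; from)

∈-tabulate⇔ : ∀ {n} {P : Fin n → Set} (P? : ∀ x → Dec (P x)) {x : Fin n} →
              x ∈ tabulate (λ y → ⌊ P? y ⌋) ⇔ P x
∈-tabulate⇔ P? {x} = mk⇔
  (λ x∈ → toWitness (from T-≡ (trans (sym (lookup∘tabulate _ x)) ([]=⇒lookup x∈))))
  (λ p → lookup⇒[]= x _ (trans (lookup∘tabulate _ x) (to T-≡ (fromWitness p))))

x∈p-y⇒x≢y : ∀ {n} (p : Subset n) {x y : Fin n} → x ∈ p - y → x ≢ y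
x∈p-y⇒x≢y (_ ∷ p) {Fin.zero}  {Fin.zero}  ()
x∈p-y⇒x≢y (_ ∷ p) {Fin.zero}  {Fin.suc y} x∈ ()
x∈p-y⇒x≢y (_ ∷ p) {Fin.suc x} {Fin.zero}  x∈ ()
x∈p-y⇒x≢y (_ ∷ p) {Fin.suc x} {Fin.suc y} (Data.Vec.there x∈) refl = x∈p-y⇒x≢y p x∈ refl

∈pair : ∀ {n} (i j : Fin n) {z} → z ∈ ⁅ i ⁆ ∪ ⁅ j ⁆ → z ≡ i ⊎ z ≡ j
∈pair i j z∈ with x∈p∪q⁻ ⁅ i ⁆ ⁅ j ⁆ z∈
... | inj₁ z∈⁅i⁆ = inj₁ (x∈⁅y⁆⇒x≡y i z∈⁅i⁆)
... | inj₂ z∈⁅j⁆ = inj₂ (x∈⁅y⁆⇒x≡y j z∈⁅j⁆)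

pair-exhausted : ∀ {n} (i j : Fin n) {x y z} → x ≢ y →
                 x ∈ ⁅ i ⁆ ∪ ⁅ j ⁆ → y ∈ ⁅ i ⁆ ∪ ⁅ j ⁆ → z ∈ ⁅ i ⁆ ∪ ⁅ j ⁆ → z ≡ x ⊎ z ≡ y
pair-exhausted i j x≢y x∈ y∈ z∈ with ∈pair i j x∈ | ∈pair i j y∈ | ∈pair i j z∈
... | inj₁ refl | inj₁ refl | _         = contradiction refl x≢y
... | inj₂ refl | inj₂ refl | _         = contradiction refl x≢y
... | inj₁ refl | _         | inj₁ refl = inj₁ refl
... | inj₂ refl | _         | inj₂ refl = inj₁ refl
... | _         | inj₁ refl | inj₁ refl = inj₂ refl
... | _         | inj₂ refl | inj₂ refl = inj₂ refl

∣p∪q∣≤∣p∣+∣q∣ : ∀ {n} (p q : Subset n) → ∣ p ∪ q ∣ ≤ ∣ p ∣ + ∣ q ∣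
∣p∪q∣≤∣p∣+∣q∣ []            []            = z≤n
∣p∪q∣≤∣p∣+∣q∣ (inside ∷ p)  (inside ∷ q)  =
  s≤s (ℕP.≤-trans (ℕP.m≤n⇒m≤1+n (∣p∪q∣≤∣p∣+∣q∣ p q)) (ℕP.≤-reflexive (sym (ℕP.+-suc ∣ p ∣ ∣ q ∣))))
∣p∪q∣≤∣p∣+∣q∣ (inside ∷ p)  (outside ∷ q) = s≤s (∣p∪q∣≤∣p∣+∣q∣ p q)
∣p∪q∣≤∣p∣+∣q∣ (outside ∷ p) (inside ∷ q)  =
  ℕP.≤-trans (s≤s (∣p∪q∣≤∣p∣+∣q∣ p q)) (ℕP.≤-reflexive (sym (ℕP.+-suc ∣ p ∣ ∣ q ∣)))
∣p∪q∣≤∣p∣+∣q∣ (outside ∷ p) (outside ∷ q) = ∣p∪q∣≤∣p∣+∣q∣ p q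

∣Empty∣≡0 : ∀ {n} (p : Subset n) → ¬ Nonempty p → ∣ p ∣ ≡ 0
∣Empty∣≡0 {n} p empty = trans (cong ∣_∣ (Empty-unique empty)) (∣⊥∣≡0 n)

∣p∣≤1+∣p-y∣ : ∀ {n} (p : Subset n) (y : Fin n) → ∣ p ∣ ≤ suc ∣ p - y ∣
∣p∣≤1+∣p-y∣ p y = begin
  ∣ p ∣                 ≤⟨ p⊆q⇒∣p∣≤∣q∣ p⊆p-y∪y ⟩
  ∣ (p - y) ∪ ⁅ y ⁆ ∣   ≤⟨ ∣p∪q∣≤∣p∣+∣q∣ (p - y) ⁅ y ⁆ ⟩
  ∣ p - y ∣ + ∣ ⁅ y ⁆ ∣ ≡⟨ cong (∣ p - y ∣ +_) (∣⁅x⁆∣≡1 y) ⟩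
  ∣ p - y ∣ + 1         ≡⟨ ℕP.+-comm ∣ p - y ∣ 1 ⟩
  suc ∣ p - y ∣         ∎
  where
  open ℕP.≤-Reasoning
  p⊆p-y∪y : p ⊆ (p - y) ∪ ⁅ y ⁆
  p⊆p-y∪y {z} z∈p with z ≟ y
  ... | yes refl = x∈p∪q⁺ (inj₂ (x∈⁅x⁆ y))
  ... | no z≢y   = x∈p∪q⁺ (inj₁ (x∈p∧x≢y⇒x∈p-y z∈p z≢y))

AtMostOne : ∀ {n} → Subset n → Set
AtMostOne p = ∀ {x y} → x ∈ p → y ∈ p → x ≡ y

∣p∣≤1⇔AtMostOne : ∀ {n} (p : Subset n) → ∣ p ∣ ≤ 1 ⇔ AtMostOne p
∣p∣≤1⇔AtMostOne {n} p = mk⇔ amo ≤1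
  where
  amo : ∣ p ∣ ≤ 1 → AtMostOne p
  amo ∣p∣≤1 {x} {y} x∈p y∈p with x ≟ y
  ... | yes x≡y = x≡y
  ... | no  x≢y = contradiction (ℕP.<-≤-trans (x∈p⇒∣p-x∣<∣p∣ x∈p) ∣p∣≤1) (ℕP.≤⇒≯ ∣y∣≤∣p-x∣)
    where
    ∣y∣≤∣p-x∣ : 1 ≤ ∣ p - x ∣
    ∣y∣≤∣p-x∣ = ℕP.≤-trans (ℕP.≤-reflexive (sym (∣⁅x⁆∣≡1 y))) (p⊆q⇒∣p∣≤∣q∣ λ z∈⁅y⁆ →
      subst (_∈ p - x) (sym (x∈⁅y⁆⇒x≡y y z∈⁅y⁆)) (x∈p∧x≢y⇒x∈p-y y∈p (λ y≡x → x≢y (sym y≡x))))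
  ≤1 : AtMostOne p → ∣ p ∣ ≤ 1
  ≤1 amo with nonempty? p
  ... | yes (x , x∈p) = ℕP.≤-trans (p⊆q⇒∣p∣≤∣q∣ p⊆⁅x⁆) (ℕP.≤-reflexive (∣⁅x⁆∣≡1 x))
    where
    p⊆⁅x⁆ : p ⊆ ⁅ x ⁆
    p⊆⁅x⁆ z∈p = subst (_∈ ⁅ x ⁆) (amo x∈p z∈p) (x∈⁅x⁆ x)
  ... | no  empty = ℕP.≤-trans (ℕP.≤-reflexive (∣Empty∣≡0 p empty)) z≤n

twoDistinct : ∀ {n} (p : Subset n) → ¬ ∣ p ∣ ≤ 1 → ∃₂ λ x y → x ∈ p × y ∈ p × x ≢ y
twoDistinct p ∣p∣≰1 with nonempty? p
... | no empty = contradiction (ℕP.≤-trans (ℕP.≤-reflexive (∣Empty∣≡0 p empty)) z≤n) ∣p∣≰1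
... | yes (x , x∈p) with nonempty? (p - x)
...   | yes (y , y∈p-x) = x , y , x∈p , p─q⊆p p ⁅ x ⁆ y∈p-x , λ x≡y → x∈p-y⇒x≢y p y∈p-x (sym x≡y)
...   | no  p-x-empty  = contradiction (from (∣p∣≤1⇔AtMostOne p) onlyX) ∣p∣≰1
  where
  isX : ∀ {z} → z ∈ p → z ≡ x
  isX {z} z∈p with z ≟ x
  ... | yes z≡x = z≡x
  ... | no  z≢x = contradiction (z , x∈p∧x≢y⇒x∈p-y z∈p z≢x) p-x-empty
  onlyX : AtMostOne p
  onlyX z∈p w∈p = trans (isX z∈p) (sym (isX w∈p))

Covers : ∀ {n m} → (Fin n → Maybe (Fin m)) → Subset n → Subset m → Set
Covers f S B = ∀ {y} → y ∈ B → ∃ λ x → x ∈ S × f x ≡ just y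

-- Pigeonhole: a set covered by a partial map on S is no larger than S.
-- Induction on S: its first point covers at most the single value f zero.
∣covered∣≤ : ∀ {n m} (f : Fin n → Maybe (Fin m)) (S : Subset n) (B : Subset m) →
             Covers f S B → ∣ B ∣ ≤ ∣ S ∣
∣covered∣≤ f [] B cov = ℕP.≤-reflexive (∣Empty∣≡0 B λ (_ , y∈B) → FinP.¬Fin0 (proj₁ (cov y∈B)))
∣covered∣≤ f (outside ∷ S) B cov = ∣covered∣≤ (λ x → f (Fin.suc x)) S B tailCovers
  where
  tailCovers : Covers (λ x → f (Fin.suc x)) S B
  tailCovers y∈B with cov y∈B
  ... | Fin.suc x , x∈ , fx≡y = x , drop-there x∈ , fx≡y
∣covered∣≤ f (inside ∷ S) B cov with f Fin.zero in f0
... | nothing = ℕP.m≤n⇒m≤1+n (∣covered∣≤ (λ x → f (Fin.suc x)) S B tailCovers)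
  where
  tailCovers : Covers (λ x → f (Fin.suc x)) S B
  tailCovers y∈B with cov y∈B
  ... | Fin.suc x , x∈ , fx≡y = x , drop-there x∈ , fx≡y
  ... | Fin.zero  , _  , f0≡y with () ← trans (sym f0) f0≡y
... | just y₀ = ℕP.≤-trans (∣p∣≤1+∣p-y∣ B y₀) (s≤s (∣covered∣≤ (λ x → f (Fin.suc x)) S (B - y₀) tailCovers))
  where
  tailCovers : Covers (λ x → f (Fin.suc x)) S (B - y₀)
  tailCovers {y} y∈ with cov (p─q⊆p B ⁅ y₀ ⁆ y∈)
  ... | Fin.suc x , x∈ , fx≡y = x , drop-there x∈ , fx≡y
  ... | Fin.zero  , _  , f0≡y = contradiction (just-injective (trans (sym f0≡y) f0)) (x∈p-y⇒x≢y B y∈)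

∣covered∣< : ∀ {n m} (f : Fin n → Maybe (Fin m)) (S : Subset n) (B : Subset m) {x₀} →
             x₀ ∈ S → Covers f (S - x₀) B → ∣ B ∣ < ∣ S ∣
∣covered∣< f S B x₀∈S cov = ℕP.<-≤-trans (s≤s (∣covered∣≤ f (S - _) B cov)) (x∈p⇒∣p-x∣<∣p∣ x₀∈S)

-- Built by matching one point of S with one of T and recursing on the remainders;
-- k bounds |S| and makes the recursion structural.
partialInjection : ∀ {n} (k : ℕ) (S T : Subset n) → ∣ S ∣ ≤ k → ∣ S ∣ ≤ ∣ T ∣ →
  Σ (Fin n → Maybe (Fin n)) λ σ → Σ (Fin n → Maybe (Fin n)) λ τ →
    ∀ {x} → x ∈ S → ∃ λ y → σ x ≡ just y × y ∈ T × τ y ≡ just x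
partialInjection zero S T ∣S∣≤0 _ =
  (λ _ → nothing) , (λ _ → nothing) , λ x∈S → contradiction (ℕP.<-≤-trans (x∈p⇒∣p-x∣<∣p∣ x∈S) ∣S∣≤0) ℕP.n≮0
partialInjection (suc k) S T ∣S∣≤1+k ∣S∣≤∣T∣ with nonempty? S
... | no S-empty = (λ _ → nothing) , (λ _ → nothing) , λ {x} x∈S → contradiction (x , x∈S) S-empty
... | yes (x₀ , x₀∈S) with nonempty? T
...   | no T-empty = contradiction (ℕP.<-≤-trans (x∈p⇒∣p-x∣<∣p∣ x₀∈S) ∣S∣≤∣T∣)
                                   (λ lt → ℕP.n≮0 (subst (_ <_) (∣Empty∣≡0 T T-empty) lt))
...   | yes (y₀ , y₀∈T) = σ , τ , matched
  where
  ∣S-x₀∣<∣S∣ = x∈p⇒∣p-x∣<∣p∣ x₀∈S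
  rest = partialInjection k (S - x₀) (T - y₀)
           (s≤s⁻¹ (ℕP.<-≤-trans ∣S-x₀∣<∣S∣ ∣S∣≤1+k))
           (s≤s⁻¹ (ℕP.<-≤-trans ∣S-x₀∣<∣S∣ (ℕP.≤-trans ∣S∣≤∣T∣ (∣p∣≤1+∣p-y∣ T y₀))))
  σ τ : Fin _ → Maybe (Fin _)
  σ x with x ≟ x₀
  ... | yes _ = just y₀
  ... | no  _ = proj₁ rest x
  τ y with y ≟ y₀
  ... | yes _ = just x₀
  ... | no  _ = proj₁ (proj₂ rest) y
  matched : ∀ {x} → x ∈ S → ∃ λ y → σ x ≡ just y × y ∈ T × τ y ≡ just x
  matched {x} x∈S with x ≟ x₀
  ... | yes refl = y₀ , refl , y₀∈T , τy₀
    where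
    τy₀ : τ y₀ ≡ just x
    τy₀ with y₀ ≟ y₀
    ... | yes _     = refl
    ... | no  y₀≢y₀ = contradiction refl y₀≢y₀
  ... | no x≢x₀ with proj₂ (proj₂ rest) (x∈p∧x≢y⇒x∈p-y x∈S x≢x₀)
  ...   | y , σx≡y , y∈T-y₀ , τ'y≡x = y , σx≡y , p─q⊆p T ⁅ y₀ ⁆ y∈T-y₀ , τy
    where
    τy : τ y ≡ just x
    τy with y ≟ y₀
    ... | yes y≡y₀ = contradiction y≡y₀ (x∈p-y⇒x≢y T y∈T-y₀)
    ... | no  _    = τ'y≡x

⌊⌋-⇔ : ∀ {A B : Set} → A ⇔ B → (a? : Dec A) (b? : Dec B) → ⌊ a? ⌋ ≡ ⌊ b? ⌋
⌊⌋-⇔ A⇔B a? b? = trans (isYes≗does a?) (trans (does-⇔ A⇔B a? b?) (sym (isYes≗does b?)))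

∣initial∣≡ : ∀ n k → k ≤ n → ∣ tabulate {n = n} (λ x → ⌊ toℕ x <? k ⌋) ∣ ≡ k
∣initial∣≡ n zero _ = ∣Empty∣≡0 {n} _ λ { (x , x∈) → ℕP.n≮0 (to (∈-tabulate⇔ (λ y → toℕ y <? 0)) x∈) }
∣initial∣≡ (suc n) (suc k) (s≤s k≤n) = cong suc (trans (cong ∣_∣ shift) (∣initial∣≡ n k k≤n))
  where
  shift : tabulate {n = n} (λ x → ⌊ suc (toℕ x) <? suc k ⌋) ≡ tabulate (λ x → ⌊ toℕ x <? k ⌋)
  shift = tabulate-cong λ x → ⌊⌋-⇔ (mk⇔ s≤s⁻¹ s≤s) (suc (toℕ x) <? suc k) (toℕ x <? k)

∣interval∣≡ : ∀ n a k → a + k ≤ n →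
              ∣ tabulate {n = n} (λ x → ⌊ (a ≤? toℕ x) ×-dec (toℕ x <? a + k) ⌋) ∣ ≡ k
∣interval∣≡ n zero k k≤n = trans (cong ∣_∣ fromZero) (∣initial∣≡ n k k≤n)
  where
  fromZero : tabulate {n = n} (λ x → ⌊ (0 ≤? toℕ x) ×-dec (toℕ x <? k) ⌋) ≡ tabulate (λ x → ⌊ toℕ x <? k ⌋)
  fromZero = tabulate-cong λ x → ⌊⌋-⇔ (mk⇔ proj₂ (z≤n ,_)) ((0 ≤? toℕ x) ×-dec (toℕ x <? k)) (toℕ x <? k)
∣interval∣≡ (suc n) (suc a) k (s≤s a+k≤n) = trans (cong ∣_∣ shift) (∣interval∣≡ n a k a+k≤n)
  where
  shift : tabulate {n = n} (λ x → ⌊ (suc a ≤? suc (toℕ x)) ×-dec (suc (toℕ x) <? suc (a + k)) ⌋)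
        ≡ tabulate (λ x → ⌊ (a ≤? toℕ x) ×-dec (toℕ x <? a + k) ⌋)
  shift = tabulate-cong λ x →
    ⌊⌋-⇔ (mk⇔ (λ (p , q) → s≤s⁻¹ p , s≤s⁻¹ q) (λ (p , q) → s≤s p , s≤s q))
         ((suc a ≤? suc (toℕ x)) ×-dec (suc (toℕ x) <? suc (a + k))) ((a ≤? toℕ x) ×-dec (toℕ x <? a + k))

⊆-large⇒⊇ : ∀ {n} {p q : Subset n} → p ⊆ q → ∣ q ∣ ≤ ∣ p ∣ → q ⊆ p
⊆-large⇒⊇ {p = p} {q} p⊆q ∣q∣≤∣p∣ {y} y∈q with y ∈? p
... | yes y∈p = y∈p
... | no  y∉p = contradiction ∣q∣≤∣p∣ (ℕP.<⇒≱ (p⊂q⇒∣p∣<∣q∣ (p⊆q , y , y∈q , y∉p)))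

module _ {n m} (f : Fin n → Maybe (Fin m)) (S : Subset n) (B : Subset m)
         (cov : Covers f S B) (∣S∣≤∣B∣ : ∣ S ∣ ≤ ∣ B ∣) where

  -- When S covers a set at least as large as itself, no point of S can be spared:
  -- f is defined on S ...
  tightCover⇒defined : ∀ {x} → x ∈ S → f x ≢ nothing
  tightCover⇒defined {x₀} x₀∈S fx₀≡nothing =
    ℕP.<⇒≱ (∣covered∣< f S B x₀∈S coverWithout) ∣S∣≤∣B∣
    where
    coverWithout : Covers f (S - x₀) B
    coverWithout y∈B with cov y∈B
    ... | x , x∈S , fx≡y =
      x , x∈p∧x≢y⇒x∈p-y x∈S (λ { refl → contradiction (trans (sym fx₀≡nothing) fx≡y) λ () }) , fx≡y

  tightCover⇒injective : ∀ {x₀ x₁ y} → x₀ ∈ S → x₁ ∈ S → f x₀ ≡ just y → f x₁ ≡ just y → x₀ ≡ x₁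
  tightCover⇒injective {x₀} {x₁} x₀∈S x₁∈S fx₀≡y fx₁≡y with x₀ ≟ x₁
  ... | yes x₀≡x₁ = x₀≡x₁
  ... | no  x₀≢x₁ = contradiction ∣S∣≤∣B∣ (ℕP.<⇒≱ (∣covered∣< f S B x₀∈S coverWithout))
    where
    coverWithout : Covers f (S - x₀) B
    coverWithout y∈B with cov y∈B
    ... | x , x∈S , fx≡y with x ≟ x₀
    ...   | no  x≢x₀ = x , x∈p∧x≢y⇒x∈p-y x∈S x≢x₀ , fx≡y
    ...   | yes refl =
      x₁ , x∈p∧x≢y⇒x∈p-y x₁∈S (λ x₁≡x₀ → x₀≢x₁ (sym x₁≡x₀)) , trans fx₁≡y (trans (sym fx₀≡y) fx≡y)

module _ (l d : ℕ) where

  private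
    Point = V l d
    W     = InW l d
    -- f ⊙ g is the composite "f after g"
    _⊙_ : PFun l d → PFun l d → PFun l d
    _⊙_ = _·_ l d

  InL : Point → Set
  InL x = toℕ x < l

  ∈L⇔ : ∀ {x} → x ∈ Lset l d ⇔ InL x
  ∈L⇔ = ∈-tabulate⇔ (λ y → toℕ y <? l)

  ValuesIn : PFun l d → Point → Subset (l + d) → Set
  ValuesIn f x F = ∀ {y} → f x ≡ just y → y ∈ F

  module _ (f : PFun l d) (F : Subset (l + d)) (x : Point) where
    private
      sameLookup : lookup (preW l d f F) x ≡ lookup (preW l d (λ _ → f x) F) x
      sameLookup = trans (lookup∘tabulate _ x) (sym (lookup∘tabulate _ x))

      atValue⁺ : ∀ m → (∀ {y} → m ≡ just y → y ∈ F) → x ∈ preW l d (λ _ → m) F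
      atValue⁺ nothing  _    = lookup⇒[]= x _ (lookup∘tabulate _ x)
      atValue⁺ (just y) vals = from (∈-tabulate⇔ (λ _ → y ∈? F)) (vals refl)

      atValue⁻ : ∀ m → x ∈ preW l d (λ _ → m) F → (∀ {y} → m ≡ just y → y ∈ F)
      atValue⁻ (just y) x∈ refl = to (∈-tabulate⇔ (λ _ → y ∈? F)) x∈

    ∈preW⁺ : ValuesIn f x F → x ∈ preW l d f F
    ∈preW⁺ vals = lookup⇒[]= x _ (trans sameLookup ([]=⇒lookup (atValue⁺ (f x) vals)))

    ∈preW⁻ : x ∈ preW l d f F → ValuesIn f x F
    ∈preW⁻ x∈ = atValue⁻ (f x) (lookup⇒[]= x _ (trans (sym sameLookup) ([]=⇒lookup x∈)))

  ∈preW-undefined : ∀ f F {x} → f x ≡ nothing → x ∈ preW l d f F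
  ∈preW-undefined f F fx≡∅ = ∈preW⁺ f F _ λ fx≡y → contradiction (trans (sym fx≡∅) fx≡y) λ ()

  ∈preW-value : ∀ f F {x y} → f x ≡ just y → y ∈ F → x ∈ preW l d f F
  ∈preW-value f F fx≡y y∈F = ∈preW⁺ f F _ λ fx≡y′ → subst (_∈ F) (just-injective (trans (sym fx≡y) fx≡y′)) y∈F

  ∈image⇔ : ∀ f A y → y ∈ image l d f A ⇔ (∃ λ x → x ∈ A × f x ≡ just y)
  ∈image⇔ f A y = ∈-tabulate⇔ (λ y → FinP.any? λ x → (x ∈? A) ×-dec ≡-dec _≟_ (f x) (just y))

  ∈Im⁺ : ∀ f {x y} → f x ≡ just y → y ∈ Im l d f
  ∈Im⁺ f fx≡y = from (∈image⇔ f ⊤ _) (_ , ∈⊤ , fx≡y)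

  ∈Im⁻ : ∀ f {y} → y ∈ Im l d f → ∃ λ x → f x ≡ just y
  ∈Im⁻ f y∈ with to (∈image⇔ f ⊤ _) y∈
  ... | x , _ , fx≡y = x , fx≡y

  ⊙-just⁻ : ∀ f g {x z} → (f ⊙ g) x ≡ just z → ∃ λ y → g x ≡ just y × f y ≡ just z
  ⊙-just⁻ f g {x} fgx≡z with g x
  ... | just y = y , refl , fgx≡z

  -- Since every pair block lies in any set containing its two points, F is a
  -- subsystem iff F contains all of L as soon as it contains two points of L.
  LClosed : Subset (l + d) → Set
  LClosed F = ∀ {x y} → x ≢ y → x ∈ F → y ∈ F → InL x → InL y → ∀ {z} → InL z → z ∈ F

  subsystem⇒LClosed : ∀ F → IsSubsystem l d F → LClosed F
  subsystem⇒LClosed F sub x≢y x∈F y∈F x∈L y∈L z∈L =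
    sub _ _ x≢y x∈F y∈F (Lset l d) (inj₁ refl) (from ∈L⇔ x∈L) (from ∈L⇔ y∈L) (from ∈L⇔ z∈L)

  LClosed⇒subsystem : ∀ F → LClosed F → IsSubsystem l d F
  LClosed⇒subsystem F closed x y x≢y x∈F y∈F _ (inj₁ refl) x∈B y∈B z∈B =
    closed x≢y x∈F y∈F (to ∈L⇔ x∈B) (to ∈L⇔ y∈B) (to ∈L⇔ z∈B)
  LClosed⇒subsystem F closed x y x≢y x∈F y∈F _ (inj₂ (i , j , _ , _ , refl)) x∈B y∈B z∈B =
    [ (λ z≡x → subst (_∈ F) (sym z≡x) x∈F) , (λ z≡y → subst (_∈ F) (sym z≡y) y∈F) ]
      (pair-exhausted i j x≢y x∈B y∈B z∈B)

  PreservesLClosed : PFun l d → Set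
  PreservesLClosed f = ∀ F → LClosed F → LClosed (preW l d f F)

  InW⁺ : ∀ f → PreservesLClosed f → W f
  InW⁺ f pres F sub = LClosed⇒subsystem _ (pres F (subsystem⇒LClosed F sub))

  InW⁻ : ∀ f → W f → PreservesLClosed f
  InW⁻ f w F closed = subsystem⇒LClosed _ (w F (LClosed⇒subsystem F closed))

  LClosed-resp : ∀ {A B} → (∀ {x} → x ∈ A → x ∈ B) → (∀ {x} → x ∈ B → x ∈ A) → LClosed A → LClosed B
  LClosed-resp A⊆B B⊆A closed x≢y x∈B y∈B x∈L y∈L z∈L = A⊆B (closed x≢y (B⊆A x∈B) (B⊆A y∈B) x∈L y∈L z∈L)

  -- W(l,d) is a monoid: it contains the identity and is closed under composition,
  -- because f^{-w} of the identity is F and (f ⊙ g)^{-w}(F) = g^{-w}(f^{-w}(F)).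
  InW-id : W (idP l d)
  InW-id = InW⁺ _ λ F → LClosed-resp
    (λ x∈F → ∈preW⁺ (idP l d) F _ λ { refl → x∈F })
    (λ x∈ → ∈preW⁻ (idP l d) F _ x∈ refl)

  InW-⊙ : ∀ f g → W f → W g → W (f ⊙ g)
  InW-⊙ f g wf wg = InW⁺ (f ⊙ g) λ F closed →
    LClosed-resp (nested⇒composite F) (composite⇒nested F)
      (InW⁻ g wg _ (InW⁻ f wf F closed))
    where
    nested⇒composite : ∀ F {x} → x ∈ preW l d g (preW l d f F) → x ∈ preW l d (f ⊙ g) F
    nested⇒composite F x∈ = ∈preW⁺ (f ⊙ g) F _ λ fgx≡z →
      let (y , gx≡y , fy≡z) = ⊙-just⁻ f g fgx≡z
      in ∈preW⁻ f F y (∈preW⁻ g _ _ x∈ gx≡y) fy≡z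
    composite⇒nested : ∀ F {x} → x ∈ preW l d (f ⊙ g) F → x ∈ preW l d g (preW l d f F)
    composite⇒nested F {x} x∈ = ∈preW⁺ g _ x λ gx≡y →
      ∈preW⁺ f F _ λ fy≡z → ∈preW⁻ (f ⊙ g) F x x∈ (trans (cong (_>>= f) gx≡y) fy≡z)

  JLeq-refl : ∀ m → JLeq l d m m
  JLeq-refl m = idP l d , idP l d , InW-id , InW-id , λ x → m≡id⊙m⊙id (m x)
    where
    m≡id⊙m⊙id : ∀ (v : Maybe Point) → v ≡ (v >>= just)
    m≡id⊙m⊙id nothing  = refl
    m≡id⊙m⊙id (just _) = refl

  JLeq-trans : ∀ {m k p} → JLeq l d m k → JLeq l d k p → JLeq l d m p
  JLeq-trans {m} {k} {p} (a , b , wa , wb , m≈akb) (a′ , b′ , wa′ , wb′ , k≈a′pb′) =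
    a ⊙ a′ , b′ ⊙ b , InW-⊙ a a′ wa wa′ , InW-⊙ b′ b wb′ wb , λ x → trans (m≈akb x) (reassociate x)
    where
    reassociate : ∀ x → ((a ⊙ k) ⊙ b) x ≡ (((a ⊙ a′) ⊙ p) ⊙ (b′ ⊙ b)) x
    reassociate x with b x
    ... | nothing = refl
    ... | just y rewrite k≈a′pb′ y with b′ y
    ...   | nothing = refl
    ...   | just z with p z
    ...     | nothing = refl
    ...     | just w with a′ w
    ...       | nothing = refl
    ...       | just _  = refl

  JRel-refl : ∀ m → JRel l d m m
  JRel-refl m = JLeq-refl m , JLeq-refl m

  JRel-sym : ∀ {m k} → JRel l d m k → JRel l d k m
  JRel-sym (m≤k , k≤m) = k≤m , m≤k

  JRel-trans : ∀ {m k p} → JRel l d m k → JRel l d k p → JRel l d m p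
  JRel-trans {m} {k} {p} (m≤k , k≤m) (k≤p , p≤k) =
    JLeq-trans {m} {k} {p} m≤k k≤p , JLeq-trans {p} {k} {m} p≤k k≤m

  -- Going down in ≤J cannot enlarge the image: Im(a k b) is covered by a on Im k.
  JLeq⇒∣Im∣≤ : ∀ {m k} → JLeq l d m k → ∣ Im l d m ∣ ≤ ∣ Im l d k ∣
  JLeq⇒∣Im∣≤ {m} {k} (a , b , _ , _ , m≈akb) = ∣covered∣≤ a (Im l d k) (Im l d m) covered
    where
    covered : Covers a (Im l d k) (Im l d m)
    covered y∈ with ∈Im⁻ m y∈
    ... | x , mx≡y with ⊙-just⁻ (a ⊙ k) b (trans (sym (m≈akb x)) mx≡y)
    ...   | z , _ , akz≡y with ⊙-just⁻ a k akz≡y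
    ...     | w , kz≡w , aw≡y = w , ∈Im⁺ k kz≡w , aw≡y

  ConstOnL : PFun l d → Set
  ConstOnL f = ∀ {x y u v} → InL x → InL y → f x ≡ just u → f y ≡ just v → u ≡ v

  constOnL⁺ : ∀ f → ∣ image l d f (Lset l d) ∣ ≤ 1 → ConstOnL f
  constOnL⁺ f ∣fL∣≤1 x∈L y∈L fx≡u fy≡v = to (∣p∣≤1⇔AtMostOne _) ∣fL∣≤1
    (from (∈image⇔ f _ _) (_ , from ∈L⇔ x∈L , fx≡u)) (from (∈image⇔ f _ _) (_ , from ∈L⇔ y∈L , fy≡v))

  constOnL⁻ : ∀ f → ConstOnL f → ∣ image l d f (Lset l d) ∣ ≤ 1
  constOnL⁻ f const = from (∣p∣≤1⇔AtMostOne _) λ u∈ v∈ →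
    let (x , x∈L , fx≡u) = to (∈image⇔ f _ _) u∈
        (y , y∈L , fy≡v) = to (∈image⇔ f _ _) v∈
    in const (to ∈L⇔ x∈L) (to ∈L⇔ y∈L) fx≡u fy≡v

  MeetsLOnce : PFun l d → Set
  MeetsLOnce f = ∀ {u v} → u ∈ Im l d f → v ∈ Im l d f → InL u → InL v → u ≡ v

  meetsLOnce⁺ : ∀ f → ∣ Im l d f ∩ Lset l d ∣ ≤ 1 → MeetsLOnce f
  meetsLOnce⁺ f ∣Im∩L∣≤1 u∈ v∈ u∈L v∈L = to (∣p∣≤1⇔AtMostOne _) ∣Im∩L∣≤1
    (x∈p∩q⁺ (u∈ , from ∈L⇔ u∈L)) (x∈p∩q⁺ (v∈ , from ∈L⇔ v∈L))

  meetsLOnce⁻ : ∀ f → MeetsLOnce f → ∣ Im l d f ∩ Lset l d ∣ ≤ 1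
  meetsLOnce⁻ f once = from (∣p∣≤1⇔AtMostOne _) λ u∈ v∈ →
    let (u∈Im , u∈L) = x∈p∩q⁻ _ _ u∈
        (v∈Im , v∈L) = x∈p∩q⁻ _ _ v∈
    in once u∈Im v∈Im (to ∈L⇔ u∈L) (to ∈L⇔ v∈L)

  UndefClosedOnL : PFun l d → Set
  UndefClosedOnL f = ∀ {x y} → x ≢ y → InL x → InL y → f x ≡ nothing → f y ≡ nothing →
                     ∀ {z} → InL z → f z ≡ nothing

  -- Elements of W have this property: take F = ∅, so that f^{-w}(∅) = V ∖ Dom f.
  InW⇒undefClosed : ∀ f → W f → UndefClosedOnL f
  InW⇒undefClosed f wf x≢y x∈L y∈L fx≡∅ fy≡∅ {z} z∈L with f z in fz
  ... | nothing = refl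
  ... | just c  = contradiction (∈preW⁻ f ⊥ z z∈dom fz) ∉⊥
    where
    z∈dom : z ∈ preW l d f ⊥
    z∈dom = InW⁻ f wf ⊥ (λ _ x∈ → contradiction x∈ ∉⊥) x≢y
              (∈preW-undefined f ⊥ fx≡∅) (∈preW-undefined f ⊥ fy≡∅) x∈L y∈L z∈L

  -- Conversely, constancy on L together with that property puts a map in W: if two
  -- points of L lie in f^{-w}(F), either one of them has its value (the common
  -- value on L) in F, or f is undefined on all of L.
  InW-criterion : ∀ f → ConstOnL f → UndefClosedOnL f → W f
  InW-criterion f const undef = InW⁺ f λ F _ {x} {y} x≢y x∈ y∈ x∈L y∈L {z} z∈L →
    ∈preW⁺ f F z (valuesIn x≢y x∈ y∈ x∈L y∈L z∈L (f x) refl (f y) refl)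
    where
    valuesIn : ∀ {F x y z} → x ≢ y → x ∈ preW l d f F → y ∈ preW l d f F → InL x → InL y → InL z →
               ∀ vx → f x ≡ vx → ∀ vy → f y ≡ vy → ValuesIn f z F
    valuesIn {F} {x} x≢y x∈ _ x∈L _ z∈L (just u) fx≡u _ _ fz≡w =
      subst (_∈ F) (const x∈L z∈L fx≡u fz≡w) (∈preW⁻ f F x x∈ fx≡u)
    valuesIn {F} {y = y} x≢y _ y∈ _ y∈L z∈L nothing _ (just u) fy≡u fz≡w =
      subst (_∈ F) (const y∈L z∈L fy≡u fz≡w) (∈preW⁻ f F y y∈ fy≡u)
    valuesIn x≢y _ _ x∈L y∈L z∈L nothing fx≡∅ nothing fy≡∅ fz≡w =
      contradiction (trans (sym fz≡w) (undef x≢y x∈L y∈L fx≡∅ fy≡∅ z∈L)) λ ()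

  record SplitsL (f : PFun l d) : Set where
    constructor splits
    field
      {x₁ x₂ a₁ a₂} : Point
      x₁∈L    : InL x₁
      x₂∈L    : InL x₂
      fx₁≡a₁  : f x₁ ≡ just a₁
      fx₂≡a₂  : f x₂ ≡ just a₂
      a₁≢a₂   : a₁ ≢ a₂

  constOnL-or-splits : ∀ f → ConstOnL f ⊎ SplitsL f
  constOnL-or-splits f with ∣ image l d f (Lset l d) ∣ ≤? 1
  ... | yes ∣fL∣≤1 = inj₁ (constOnL⁺ f ∣fL∣≤1)
  ... | no  ∣fL∣≰1 with twoDistinct _ ∣fL∣≰1
  ...   | a₁ , a₂ , a₁∈ , a₂∈ , a₁≢a₂ with to (∈image⇔ f _ _) a₁∈ | to (∈image⇔ f _ _) a₂∈
  ...     | x₁ , x₁∈L , fx₁≡a₁ | x₂ , x₂∈L , fx₂≡a₂ =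
    inj₂ (splits (to ∈L⇔ x₁∈L) (to ∈L⇔ x₂∈L) fx₁≡a₁ fx₂≡a₂ a₁≢a₂)

  LClosed-⁅⁆ : ∀ a → LClosed ⁅ a ⁆
  LClosed-⁅⁆ a x≢y x∈ y∈ _ _ _ = contradiction (trans (x∈⁅y⁆⇒x≡y a x∈) (sym (x∈⁅y⁆⇒x≡y a y∈))) x≢y

  -- An element of W splitting L is defined and injective on L: the singleton of one
  -- of its values is L-closed, so its w-preimage contains at most one point of L
  -- unless it contains all of L.
  module _ {f} (wf : W f) (s : SplitsL f) where
    open SplitsL s

    splits⇒defined : ∀ {z} → InL z → ∃ λ c → f z ≡ just c
    splits⇒defined {z} z∈L with f z in fz
    ... | just c  = c , refl
    ... | nothing = contradiction (sym (x∈⁅y⁆⇒x≡y a₁ (∈preW⁻ f ⁅ a₁ ⁆ x₂ x₂∈ fx₂≡a₂))) a₁≢a₂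
      where
      x₁≢z : x₁ ≢ z
      x₁≢z refl = contradiction (trans (sym fx₁≡a₁) fz) λ ()
      x₂∈ : x₂ ∈ preW l d f ⁅ a₁ ⁆
      x₂∈ = InW⁻ f wf ⁅ a₁ ⁆ (LClosed-⁅⁆ a₁) x₁≢z
              (∈preW-value f ⁅ a₁ ⁆ fx₁≡a₁ (x∈⁅x⁆ a₁)) (∈preW-undefined f ⁅ a₁ ⁆ fz) x₁∈L z∈L x₂∈L

    splits⇒injective : ∀ {z w c} → InL z → InL w → f z ≡ just c → f w ≡ just c → z ≡ w
    splits⇒injective {z} {w} {c} z∈L w∈L fz≡c fw≡c with z ≟ w
    ... | yes z≡w = z≡w
    ... | no  z≢w = contradiction (trans (valueIsC x₁∈L fx₁≡a₁) (sym (valueIsC x₂∈L fx₂≡a₂))) a₁≢a₂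
      where
      valueIsC : ∀ {t u} → InL t → f t ≡ just u → u ≡ c
      valueIsC t∈L ft≡u = x∈⁅y⁆⇒x≡y c
        (∈preW⁻ f ⁅ c ⁆ _ (InW⁻ f wf ⁅ c ⁆ (LClosed-⁅⁆ c) z≢w
          (∈preW-value f ⁅ c ⁆ fz≡c (x∈⁅x⁆ c)) (∈preW-value f ⁅ c ⁆ fw≡c (x∈⁅x⁆ c)) z∈L w∈L t∈L) ft≡u)

  -- Take a partial injection σ : Im f → Im g with
  -- partial inverse τ, and put f = a ⊙ g ⊙ b where b x is a g-preimage of σ (f x),
  -- and a = τ except on L, where a is constantly τ at the L-point of Im g; this
  -- agrees with τ on Im g and makes both a and b constant on L, hence in W.
  module _ (f g : PFun l d) (wf : W f) (const : ConstOnL f)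
           (∣Imf∣≤∣Img∣ : ∣ Im l d f ∣ ≤ ∣ Im l d g ∣) (once : MeetsLOnce g) where
    private
      injection = partialInjection ∣ Im l d f ∣ (Im l d f) (Im l d g) ℕP.≤-refl ∣Imf∣≤∣Img∣
      σ τ : PFun l d
      σ = proj₁ injection
      τ = proj₁ (proj₂ injection)
      matched : ∀ {p} → p ∈ Im l d f → ∃ λ q → σ p ≡ just q × q ∈ Im l d g × τ q ≡ just p
      matched = proj₂ (proj₂ injection)

      preimage : PFun l d
      preimage y with FinP.any? (λ x → ≡-dec _≟_ (g x) (just y))
      ... | yes (x , _) = just x
      ... | no  _       = nothing

      preimage-spec : ∀ {y} → y ∈ Im l d g → ∃ λ x → preimage y ≡ just x × g x ≡ just y
      preimage-spec {y} y∈ with FinP.any? (λ x → ≡-dec _≟_ (g x) (just y))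
      ... | yes (x , gx≡y) = x , refl , gx≡y
      ... | no  noPreimage = contradiction (∈Im⁻ g y∈) noPreimage

      pointInL : Maybe Point
      pointInL with FinP.any? (λ u → (u ∈? Im l d g) ×-dec (toℕ u <? l))
      ... | yes (u , _) = just u
      ... | no  _       = nothing

      pointInL-spec : ∀ {u} → u ∈ Im l d g → InL u → pointInL ≡ just u
      pointInL-spec {u} u∈ u∈L with FinP.any? (λ u → (u ∈? Im l d g) ×-dec (toℕ u <? l))
      ... | yes (u′ , u′∈ , u′∈L) = cong just (once u′∈ u∈ u′∈L u∈L)
      ... | no  none             = contradiction (u , u∈ , u∈L) none

      a : PFun l d
      a x with toℕ x <? l
      ... | yes _ = pointInL >>= τ
      ... | no  _ = τ x

      a-onL : ∀ {x} → InL x → a x ≡ (pointInL >>= τ)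
      a-onL {x} x∈L with toℕ x <? l
      ... | yes _   = refl
      ... | no  x∉L = contradiction x∈L x∉L

      a-inverts : ∀ {q p} → q ∈ Im l d g → τ q ≡ just p → a q ≡ just p
      a-inverts {q} q∈ τq≡p with toℕ q <? l
      ... | yes q∈L = trans (cong (_>>= τ) (pointInL-spec q∈ q∈L)) τq≡p
      ... | no  _   = τq≡p

      send : Maybe Point → Maybe Point
      send v = (v >>= σ) >>= preimage

      b : PFun l d
      b x = send (f x)

      roundTrip : ∀ {p} → p ∈ Im l d f → ∃ λ z → send (just p) ≡ just z × (g z >>= a) ≡ just p
      roundTrip p∈ with matched p∈
      ... | q , σp≡q , q∈ , τq≡p with preimage-spec q∈
      ...   | z , preq≡z , gz≡q =
        z , trans (cong (_>>= preimage) σp≡q) preq≡z , trans (cong (_>>= a) gz≡q) (a-inverts q∈ τq≡p)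

      factorisation : ∀ x → f x ≡ ((a ⊙ g) ⊙ b) x
      factorisation x with f x in fx
      ... | nothing = refl
      ... | just p with roundTrip (∈Im⁺ f fx)
      ...   | z , sendp≡z , agz≡p = sym (trans (cong (_>>= λ z → g z >>= a) sendp≡z) agz≡p)

      a∈W : W a
      a∈W = InW-criterion a
        (λ x∈L y∈L ax≡u ay≡v →
          just-injective (trans (sym ax≡u) (trans (trans (a-onL x∈L) (sym (a-onL y∈L))) ay≡v)))
        (λ _ x∈L _ ax≡∅ _ z∈L → trans (a-onL z∈L) (trans (sym (a-onL x∈L)) ax≡∅))

      sentFrom : ∀ v {z} → send v ≡ just z → ∃ λ p → v ≡ just p
      sentFrom (just p) _ = p , refl

      b-undefined : ∀ {x} → b x ≡ nothing → f x ≡ nothing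
      b-undefined {x} bx≡∅ with f x in fx
      ... | nothing = refl
      ... | just p with roundTrip (∈Im⁺ f fx)
      ...   | z , sendp≡z , _ = contradiction (trans (sym sendp≡z) bx≡∅) λ ()

      b∈W : W b
      b∈W = InW-criterion b b-const
        (λ x≢y x∈L y∈L bx≡∅ by≡∅ z∈L →
          cong send (InW⇒undefClosed f wf x≢y x∈L y∈L (b-undefined bx≡∅) (b-undefined by≡∅) z∈L))
        where
        b-const : ConstOnL b
        b-const {x} {y} x∈L y∈L bx≡u by≡v with sentFrom (f x) bx≡u | sentFrom (f y) by≡v
        ... | p , fx≡p | p′ , fy≡p′ = just-injective (begin
          just _          ≡⟨ sym bx≡u ⟩
          send (f x)      ≡⟨ cong send (trans fx≡p (cong just (const x∈L y∈L fx≡p fy≡p′))) ⟩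
          send (just p′)  ≡⟨ cong send (sym fy≡p′) ⟩
          send (f y)      ≡⟨ by≡v ⟩
          just _          ∎)
          where open ≡-Reasoning

    JLeq-byImageSize : JLeq l d f g
    JLeq-byImageSize = a , b , a∈W , b∈W , factorisation

  -- Since |f(L)| ≤ 1 and |D| = d, a map constant on L has at most d + 1 values.
  ∣Im∣≤1+d : ∀ f → ConstOnL f → ∣ Im l d f ∣ ≤ suc d
  ∣Im∣≤1+d f const = begin
    ∣ Im l d f ∣                          ≤⟨ p⊆q⇒∣p∣≤∣q∣ Im⊆fL∪fD ⟩
    ∣ image l d f L ∪ image l d f (∁ L) ∣  ≤⟨ ∣p∪q∣≤∣p∣+∣q∣ (image l d f L) (image l d f (∁ L)) ⟩
    ∣ image l d f L ∣ + ∣ image l d f (∁ L) ∣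
      ≤⟨ ℕP.+-mono-≤ (constOnL⁻ f const) (∣covered∣≤ f (∁ L) _ λ y∈ → to (∈image⇔ f _ _) y∈) ⟩
    1 + ∣ ∁ L ∣                           ≡⟨ cong suc ∣∁L∣≡d ⟩
    suc d                                 ∎
    where
    open ℕP.≤-Reasoning
    L = Lset l d
    ∣∁L∣≡d : ∣ ∁ L ∣ ≡ d
    ∣∁L∣≡d = trans (∣∁p∣≡n∸∣p∣ L)
               (trans (cong (l + d ∸_) (∣initial∣≡ (l + d) l (ℕP.m≤m+n l d))) (ℕP.m+n∸m≡n l d))
    Im⊆fL∪fD : Im l d f ⊆ image l d f L ∪ image l d f (∁ L)
    Im⊆fL∪fD {y} y∈ with ∈Im⁻ f y∈
    ... | x , fx≡y with x ∈? L
    ...   | yes x∈L = x∈p∪q⁺ (inj₁ (from (∈image⇔ f L y) (x , x∈L , fx≡y)))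
    ...   | no  x∉L = x∈p∪q⁺ (inj₂ (from (∈image⇔ f (∁ L) y) (x , x∉p⇒x∈∁p x∉L , fx≡y)))

  module _ (l≥3 : 3 ≤ l) where

    pointOfL : ∀ k → k < 3 → ∃ λ t → InL t × toℕ t ≡ k
    pointOfL k k<3 = t , subst (_< l) (sym (FinP.toℕ-fromℕ< _)) k<l , FinP.toℕ-fromℕ< _
      where
      k<l = ℕP.<-≤-trans k<3 l≥3
      t = fromℕ< (ℕP.<-≤-trans k<l (ℕP.m≤m+n l d))

    thirdPointOfL : ∀ z w → ∃ λ t → InL t × t ≢ z × t ≢ w
    thirdPointOfL z w with avoid (toℕ z) (toℕ w)
      where
      avoid : ∀ a b → ∃ λ k → k < 3 × k ≢ a × k ≢ b
      avoid 0 1 = 2 , ℕP.≤-refl , (λ ()) , (λ ())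
      avoid 1 0 = 2 , ℕP.≤-refl , (λ ()) , (λ ())
      avoid 0 (suc (suc _)) = 1 , s≤s (s≤s z≤n) , (λ ()) , (λ ())
      avoid 0 0 = 1 , s≤s (s≤s z≤n) , (λ ()) , (λ ())
      avoid (suc (suc _)) 0 = 1 , s≤s (s≤s z≤n) , (λ ()) , (λ ())
      avoid (suc _) (suc _) = 0 , s≤s z≤n , (λ ()) , (λ ())
    ... | k , k<3 , k≢z , k≢w with pointOfL k k<3
    ...   | t , t∈L , t≡k = t , t∈L , (λ t≡z → k≢z (trans (sym t≡k) (cong toℕ t≡z)))
                                    , (λ t≡w → k≢w (trans (sym t≡k) (cong toℕ t≡w)))

    LClosed-pair : ∀ {c} e → ¬ InL c → LClosed (⁅ c ⁆ ∪ ⁅ e ⁆)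
    LClosed-pair {c} e c∉L x≢y x∈ y∈ x∈L y∈L _ with ∈pair c e x∈ | ∈pair c e y∈
    ... | inj₁ refl | _         = contradiction x∈L c∉L
    ... | _         | inj₁ refl = contradiction y∈L c∉L
    ... | inj₂ refl | inj₂ refl = contradiction refl x≢y

    -- If z ∈ L had f z = c ∉ L, pick
    -- w ∈ L with a different value e; then {c, e} is L-closed, so its w-preimage
    -- contains a third point t of L, whose value c or e contradicts injectivity on L.
    splits⇒intoL : ∀ {f} → W f → SplitsL f → ∀ {z c} → InL z → f z ≡ just c → InL c
    splits⇒intoL {f} wf s {z} {c} z∈L fz≡c with toℕ c <? l
    ... | yes c∈L = c∈L
    ... | no  c∉L with otherValue
      where
      open SplitsL s
      otherValue : ∃ λ w → ∃ λ e → InL w × f w ≡ just e × e ≢ c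
      otherValue with a₁ ≟ c
      ... | yes refl = x₂ , a₂ , x₂∈L , fx₂≡a₂ , λ a₂≡a₁ → a₁≢a₂ (sym a₂≡a₁)
      ... | no  a₁≢c = x₁ , a₁ , x₁∈L , fx₁≡a₁ , a₁≢c
    ... | w , e , w∈L , fw≡e , e≢c with thirdPointOfL z w
    ...   | t , t∈L , t≢z , t≢w with splits⇒defined wf s t∈L
    ...     | v , ft≡v with ∈pair c e (∈preW⁻ f F t t∈F ft≡v)
      where
      F = ⁅ c ⁆ ∪ ⁅ e ⁆
      z≢w : z ≢ w
      z≢w refl = e≢c (just-injective (trans (sym fw≡e) fz≡c))
      t∈F : t ∈ preW l d f F
      t∈F = InW⁻ f wf F (LClosed-pair e c∉L) z≢w
              (∈preW-value f F fz≡c (x∈p∪q⁺ (inj₁ (x∈⁅x⁆ c)))) (∈preW-value f F fw≡e (x∈p∪q⁺ (inj₂ (x∈⁅x⁆ e))))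
              z∈L w∈L t∈L
    ... | inj₁ refl = contradiction (splits⇒injective wf s t∈L z∈L ft≡v fz≡c) t≢z
    ... | inj₂ refl = contradiction (splits⇒injective wf s t∈L w∈L ft≡v fw≡e) t≢w

    -- For f ∈ W: if Im f meets L at most once, f is constant on L (a splitting f
    -- would have two distinct values in L).
    meetsLOnce⇒constOnL : ∀ f → W f → MeetsLOnce f → ConstOnL f
    meetsLOnce⇒constOnL f wf once {x} {y} {u} {v} x∈L y∈L fx≡u fy≡v with u ≟ v
    ... | yes u≡v = u≡v
    ... | no  u≢v = once (∈Im⁺ f fx≡u) (∈Im⁺ f fy≡v) (splits⇒intoL wf s x∈L fx≡u) (splits⇒intoL wf s y∈L fy≡v)
      where
      s : SplitsL f
      s = splits x∈L y∈L fx≡u fy≡v u≢v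

    -- If f = f g f had two
    -- values u ≠ v in L, then g u, g v are defined with f (g u) = u ≠ v = f (g v);
    -- so g splits L, hence maps u, v into L, and constancy of f on L gives u = v.
    regular⇒meetsLOnce : ∀ f → ConstOnL f → IsRegular l d f → MeetsLOnce f
    regular⇒meetsLOnce f const (_ , g , wg , fgf≈f) {u} {v} u∈ v∈ u∈L v∈L with u ≟ v
    ... | yes u≡v = u≡v
    ... | no  u≢v with section u∈ | section v∈
      where
      section : ∀ {y} → y ∈ Im l d f → ∃ λ y′ → g y ≡ just y′ × f y′ ≡ just y
      section y∈ with ∈Im⁻ f y∈
      ... | x , fx≡y = ⊙-just⁻ f g (trans (cong (_>>= (f ⊙ g)) (sym fx≡y)) (trans (fgf≈f x) fx≡y))
    ... | u′ , gu≡u′ , fu′≡u | v′ , gv≡v′ , fv′≡v =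
      const (splits⇒intoL wg s u∈L gu≡u′) (splits⇒intoL wg s v∈L gv≡v′) fu′≡u fv′≡v
      where
      s : SplitsL g
      s = splits u∈L v∈L gu≡u′ gv≡v′ λ { refl → u≢v (just-injective (trans (sym fu′≡u) fv′≡v)) }

    -- Write e = a h b.  Then a maps
    -- Im h onto a set covering Im e, which is at least as large as Im h; so a is
    -- defined and injective on Im h and a(Im h) = Im e.  Two points u ≠ v of
    -- Im h ∩ L would thus have distinct images, which lie in L because a splits L,
    -- and in Im e.
    meetsLOnce-J : ∀ {h e} → JRel l d h e → MeetsLOnce e → MeetsLOnce h
    meetsLOnce-J {h} {e} (h≤e , (a , b , wa , _ , e≈ahb)) once {u} {v} u∈ v∈ u∈L v∈L =
      tightCover⇒injective a S B cover ∣S∣≤∣B∣ u∈ v∈ au≡u′ (trans av≡v′ (cong just (sym u′≡v′)))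
      where
      S = Im l d h
      B = image l d a S
      cover : Covers a S B
      cover y∈ = to (∈image⇔ a S _) y∈
      Ime⊆B : Im l d e ⊆ B
      Ime⊆B y∈ with ∈Im⁻ e y∈
      ... | x , ex≡y with ⊙-just⁻ (a ⊙ h) b (trans (sym (e≈ahb x)) ex≡y)
      ...   | z , _ , ahz≡y with ⊙-just⁻ a h ahz≡y
      ...     | w , hz≡w , aw≡y = from (∈image⇔ a S _) (w , ∈Im⁺ h hz≡w , aw≡y)
      ∣B∣≤∣S∣ = ∣covered∣≤ a S B cover
      ∣S∣≤∣B∣ = ℕP.≤-trans (JLeq⇒∣Im∣≤ {h} {e} h≤e) (p⊆q⇒∣p∣≤∣q∣ Ime⊆B)
      B⊆Ime = ⊆-large⇒⊇ Ime⊆B (ℕP.≤-trans ∣B∣≤∣S∣ (JLeq⇒∣Im∣≤ {h} {e} h≤e))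
      valueAt : ∀ {x} → x ∈ S → ∃ λ y → a x ≡ just y
      valueAt {x} x∈ with a x in ax
      ... | just y  = y , refl
      ... | nothing = contradiction ax (tightCover⇒defined a S B cover ∣S∣≤∣B∣ x∈)
      u′ = proj₁ (valueAt u∈)
      au≡u′ = proj₂ (valueAt u∈)
      v′ = proj₁ (valueAt v∈)
      av≡v′ = proj₂ (valueAt v∈)
      u′≡v′ : u′ ≡ v′
      u′≡v′ with u′ ≟ v′
      ... | yes u′≡v′ = u′≡v′
      ... | no  u′≢v′ = once (B⊆Ime (from (∈image⇔ a S _) (u , u∈ , au≡u′)))
                             (B⊆Ime (from (∈image⇔ a S _) (v , v∈ , av≡v′)))
                             (splits⇒intoL wa s u∈L au≡u′) (splits⇒intoL wa s v∈L av≡v′)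
        where
        s : SplitsL a
        s = splits u∈L v∈L au≡u′ av≡v′ u′≢v′

    -- For each i ≤ d + 1, J_i contains an idempotent.  For i = j + 1 it sends L to
    -- its last point p₀ = l - 1, fixes the first j points of D and is undefined
    -- elsewhere; its image is the interval [l - 1, l + j).
    module Idempotent (j : ℕ) (j≤d : j ≤ d) where
      1+[l-1]≡l : suc (l ∸ 1) ≡ l
      1+[l-1]≡l = ℕP.suc-pred l {{>-nonZero (ℕP.≤-trans (s≤s z≤n) l≥3)}}

      l-1<l : l ∸ 1 < l
      l-1<l = ℕP.≤-reflexive 1+[l-1]≡l

      p₀ : Point
      p₀ = fromℕ< (ℕP.<-≤-trans l-1<l (ℕP.m≤m+n l d))

      E : PFun l d
      E x with toℕ x <? l
      ... | yes _ = just p₀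
      ... | no  _ with toℕ x <? l + j
      ...   | yes _ = just x
      ...   | no  _ = nothing

      InT : Point → Set
      InT y = l ∸ 1 ≤ toℕ y × toℕ y < l ∸ 1 + suc j

      InT? : ∀ y → Dec (InT y)
      InT? y = (l ∸ 1 ≤? toℕ y) ×-dec (toℕ y <? l ∸ 1 + suc j)

      T : Subset (l + d)
      T = tabulate (λ y → ⌊ InT? y ⌋)

      l-1+1+j≡l+j : l ∸ 1 + suc j ≡ l + j
      l-1+1+j≡l+j = trans (ℕP.+-suc (l ∸ 1) j) (cong (_+ j) 1+[l-1]≡l)

      E-onL : ∀ {x} → InL x → E x ≡ just p₀
      E-onL {x} x∈L with toℕ x <? l
      ... | yes _   = refl
      ... | no  x∉L = contradiction x∈L x∉L

      T∩L≡p₀ : ∀ {y} → InT y → InL y → y ≡ p₀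
      T∩L≡p₀ (l-1≤y , _) y∈L = FinP.toℕ-injective (trans
        (ℕP.≤-antisym (s≤s⁻¹ (ℕP.≤-trans y∈L (ℕP.≤-reflexive (sym 1+[l-1]≡l)))) l-1≤y)
        (sym (FinP.toℕ-fromℕ< _)))

      E-fixes : ∀ {y} → InT y → E y ≡ just y
      E-fixes {y} y∈T with toℕ y <? l
      ... | yes y∈L = cong just (sym (T∩L≡p₀ y∈T y∈L))
      ... | no  _ with toℕ y <? l + j
      ...   | yes _        = refl
      ...   | no  y≮l+j    = contradiction (subst (toℕ y <_) l-1+1+j≡l+j (proj₂ y∈T)) y≮l+j

      E-intoT : ∀ {x y} → E x ≡ just y → InT y
      E-intoT {x} Ex≡y with toℕ x <? l
      ... | yes _ with refl ← Ex≡y = ℕP.≤-reflexive (sym (FinP.toℕ-fromℕ< _)) , p₀<bound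
        where
        p₀<bound : toℕ p₀ < l ∸ 1 + suc j
        p₀<bound = subst (_< l ∸ 1 + suc j) (sym (FinP.toℕ-fromℕ< _)) (ℕP.m<m+n (l ∸ 1) (s≤s z≤n))
      ... | no x∉L with toℕ x <? l + j
      ...   | yes x<l+j with refl ← Ex≡y =
        ℕP.≤-trans (ℕP.m∸n≤m l 1) (ℕP.≮⇒≥ x∉L) , subst (toℕ x <_) (sym l-1+1+j≡l+j) x<l+j

      ImE≡T : Im l d E ≡ T
      ImE≡T = ⊆-antisym
        (λ y∈ → from (∈-tabulate⇔ InT?) (E-intoT (proj₂ (∈Im⁻ E y∈))))
        (λ y∈ → ∈Im⁺ E (E-fixes (to (∈-tabulate⇔ InT?) y∈)))

      ∣T∣≡1+j : ∣ T ∣ ≡ suc j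
      ∣T∣≡1+j = ∣interval∣≡ (l + d) (l ∸ 1) (suc j)
                  (ℕP.≤-trans (ℕP.≤-reflexive l-1+1+j≡l+j) (ℕP.+-monoʳ-≤ l j≤d))

      E∈J : Jset l d (suc j) E
      E∈J = InW-criterion E E-const (λ _ x∈L _ Ex≡∅ _ _ → contradiction (trans (sym (E-onL x∈L)) Ex≡∅) λ ())
          , meetsLOnce⁻ E (λ u∈ v∈ u∈L v∈L → trans (T∩L≡p₀ (inT u∈) u∈L) (sym (T∩L≡p₀ (inT v∈) v∈L)))
          , trans (cong ∣_∣ ImE≡T) ∣T∣≡1+j
        where
        E-const : ConstOnL E
        E-const x∈L y∈L Ex≡u Ey≡v =
          just-injective (trans (sym Ex≡u) (trans (trans (E-onL x∈L) (sym (E-onL y∈L))) Ey≡v))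
        inT : ∀ {y} → y ∈ Im l d E → InT y
        inT y∈ = E-intoT (proj₂ (∈Im⁻ E y∈))

      E-idempotent : ∀ x → (E ⊙ E) x ≡ E x
      E-idempotent x with E x in Ex
      ... | nothing = refl
      ... | just y  = E-fixes (E-intoT Ex)

    idempotentIn : ∀ i → i ≤ suc d → ∃ λ e → Jset l d i e × IsIdempotent l d e
    idempotentIn zero _ = empty , empty∈J₀ , InW-empty , λ _ → refl
      where
      empty : PFun l d
      empty _ = nothing
      noValue : ∀ {y} → ¬ y ∈ Im l d empty
      noValue y∈ with () ← proj₂ (∈Im⁻ empty y∈)
      InW-empty : W empty
      InW-empty = InW-criterion empty (λ _ _ ()) (λ _ _ _ _ _ _ → refl)
      empty∈J₀ : Jset l d 0 empty
      empty∈J₀ = InW-empty , meetsLOnce⁻ empty (λ u∈ → contradiction u∈ noValue)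
               , ∣Empty∣≡0 _ λ (_ , y∈) → noValue y∈
    idempotentIn (suc j) (s≤s j≤d) = E , E∈J , proj₁ E∈J , E-idempotent
      where open Idempotent j j≤d

    idempotent⇒regular : ∀ e → IsIdempotent l d e → IsRegular l d e
    idempotent⇒regular e (we , ee≈e) = we , e , we , eee≈e
      where
      eee≈e : ∀ x → ((e ⊙ e) ⊙ e) x ≡ e x
      eee≈e x with e x in ex
      ... | nothing = refl
      ... | just y  = trans (ee≈e y) (trans (cong (_>>= e) (sym ex)) (trans (ee≈e x) ex))

    Iset⇒constOnL : ∀ {f} → Iset l d f → ConstOnL f
    Iset⇒constOnL {f} (_ , ∣fL∣≤1) = constOnL⁺ f ∣fL∣≤1

    Jset⊆Iset : ∀ i g → Jset l d i g → Iset l d g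
    Jset⊆Iset i g (wg , ∣Img∩L∣≤1 , _) = wg , constOnL⁻ g (meetsLOnce⇒constOnL g wg (meetsLOnce⁺ g ∣Img∩L∣≤1))

    JLeq-inI : ∀ {g h} → Iset l d g → MeetsLOnce h → ∣ Im l d g ∣ ≤ ∣ Im l d h ∣ → JLeq l d g h
    JLeq-inI {g} {h} Ig once ∣Img∣≤∣Imh∣ = JLeq-byImageSize g h (proj₁ Ig) (Iset⇒constOnL Ig) ∣Img∣≤∣Imh∣ once

    JClassOf : PFun l d → PSet l d
    JClassOf f g = W g × JRel l d g f

    Jset≐JClass : ∀ i e → Jset l d i e → _≐_ l d (Jset l d i) (JClassOf e)
    Jset≐JClass i e Je@(_ , ∣Ime∩L∣≤1 , ∣Ime∣≡i) g = mk⇔ toClass fromClass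
      where
      toClass : Jset l d i g → JClassOf e g
      toClass Jg@(wg , ∣Img∩L∣≤1 , ∣Img∣≡i) =
        wg , JLeq-inI (Jset⊆Iset i g Jg) (meetsLOnce⁺ e ∣Ime∩L∣≤1)
                      (ℕP.≤-reflexive (trans ∣Img∣≡i (sym ∣Ime∣≡i)))
           , JLeq-inI (Jset⊆Iset i e Je) (meetsLOnce⁺ g ∣Img∩L∣≤1)
                      (ℕP.≤-reflexive (trans ∣Ime∣≡i (sym ∣Img∣≡i)))
      fromClass : JClassOf e g → Jset l d i g
      fromClass (wg , g≤e , e≤g) =
        wg , meetsLOnce⁻ g (meetsLOnce-J {g} {e} (g≤e , e≤g) (meetsLOnce⁺ e ∣Ime∩L∣≤1))
           , trans (ℕP.≤-antisym (JLeq⇒∣Im∣≤ {g} {e} g≤e) (JLeq⇒∣Im∣≤ {e} {g} e≤g)) ∣Ime∣≡i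

    JClassOf-resp : ∀ {e f} → JRel l d e f → _≐_ l d (JClassOf f) (JClassOf e)
    JClassOf-resp {e} {f} e~f g = mk⇔
      (λ (wg , g~f) → wg , JRel-trans {g} {f} {e} g~f (JRel-sym {e} {f} e~f))
      (λ (wg , g~e) → wg , JRel-trans {g} {e} {f} g~e e~f)

    ≐-trans : ∀ {A B C : PSet l d} → _≐_ l d A B → _≐_ l d B C → _≐_ l d A C
    ≐-trans A≐B B≐C f = ⇔-trans (A≐B f) (B≐C f)

    ≐-sym : ∀ {A B : PSet l d} → _≐_ l d A B → _≐_ l d B A
    ≐-sym A≐B f = ⇔-sym (A≐B f)

    ⊙-constOnLʳ : ∀ f g → ConstOnL g → ConstOnL (f ⊙ g)
    ⊙-constOnLʳ f g const x∈L y∈L fgx≡u fgy≡v with ⊙-just⁻ f g fgx≡u | ⊙-just⁻ f g fgy≡v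
    ... | p , gx≡p , fp≡u | q , gy≡q , fq≡v with refl ← const x∈L y∈L gx≡p gy≡q =
      just-injective (trans (sym fp≡u) fq≡v)

    ⊙-constOnLˡ : ∀ f g → (∀ {x y} → InL x → g x ≡ just y → InL y) → ConstOnL f → ConstOnL (f ⊙ g)
    ⊙-constOnLˡ f g intoL const x∈L y∈L fgx≡u fgy≡v with ⊙-just⁻ f g fgx≡u | ⊙-just⁻ f g fgy≡v
    ... | p , gx≡p , fp≡u | q , gy≡q , fq≡v = const (intoL x∈L gx≡p) (intoL y∈L gy≡q) fp≡u fq≡v

    ∉I⇒splits : ∀ f → W f → ¬ Iset l d f → SplitsL f
    ∉I⇒splits f wf f∉I with constOnL-or-splits f
    ... | inj₁ const = contradiction (wf , constOnL⁻ f const) f∉I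
    ... | inj₂ s     = s

    -- It absorbs products on the left (constancy passes to
    -- f ⊙ g) and on the right (g either is constant or maps L into L); the identity
    -- is not constant on L; and if f, g split L, then g maps two points of L to
    -- distinct points of L, on which f is defined and injective, so f ⊙ g splits L.
    I-prime : IsPrimeIdeal l d (Iset l d)
    I-prime = ((λ _ → proj₁) , (empty , Jset⊆Iset 0 empty empty∈J₀) , leftAbsorbs , rightAbsorbs)
            , id∉I , outsideClosed
      where
      empty = proj₁ (idempotentIn 0 z≤n)
      empty∈J₀ = proj₁ (proj₂ (idempotentIn 0 z≤n))
      leftAbsorbs : ∀ m f → W m → Iset l d f → Iset l d (m ⊙ f)
      leftAbsorbs m f wm If@(wf , _) = InW-⊙ m f wm wf , constOnL⁻ (m ⊙ f) (⊙-constOnLʳ m f (Iset⇒constOnL If))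
      rightAbsorbs : ∀ m f → W m → Iset l d f → Iset l d (f ⊙ m)
      rightAbsorbs m f wm If@(wf , _) = InW-⊙ f m wf wm , constOnL⁻ (f ⊙ m) constComposite
        where
        constComposite : ConstOnL (f ⊙ m)
        constComposite with constOnL-or-splits m
        ... | inj₁ const = ⊙-constOnLʳ f m const
        ... | inj₂ s     = ⊙-constOnLˡ f m (splits⇒intoL wm s) (Iset⇒constOnL If)
      id∉I : ¬ Iset l d (idP l d)
      id∉I Iid with pointOfL 0 (s≤s z≤n) | pointOfL 1 (s≤s (s≤s z≤n))
      ... | t₀ , t₀∈L , t₀≡0 | t₁ , t₁∈L , t₁≡1
        with () ← trans (sym t₀≡0) (trans (cong toℕ (Iset⇒constOnL Iid t₀∈L t₁∈L refl refl)) t₁≡1)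
      outsideClosed : ∀ f g → W f → W g → ¬ Iset l d f → ¬ Iset l d g → ¬ Iset l d (f ⊙ g)
      outsideClosed f g wf wg f∉I g∉I Ifg = a₁≢a₂ (splits⇒injective wf sf a₁∈L a₂∈L fa₁≡c fa₂≡c)
        where
        sf = ∉I⇒splits f wf f∉I
        sg = ∉I⇒splits g wg g∉I
        open SplitsL sg
        a₁∈L = splits⇒intoL wg sg x₁∈L fx₁≡a₁
        a₂∈L = splits⇒intoL wg sg x₂∈L fx₂≡a₂
        c  = proj₁ (splits⇒defined wf sf a₁∈L)
        fa₁≡c = proj₂ (splits⇒defined wf sf a₁∈L)
        c′ = proj₁ (splits⇒defined wf sf a₂∈L)
        fa₂≡c′ = proj₂ (splits⇒defined wf sf a₂∈L)
        c≡c′ : c ≡ c′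
        c≡c′ = Iset⇒constOnL Ifg x₁∈L x₂∈L
                 (trans (cong (_>>= f) fx₁≡a₁) fa₁≡c) (trans (cong (_>>= f) fx₂≡a₂) fa₂≡c′)
        fa₂≡c : f a₂ ≡ just c
        fa₂≡c = trans fa₂≡c′ (cong just (sym c≡c′))

    -- (ii) Regular elements of I are J-related iff their images have equal size:
    -- regular elements of I meet L once, so each is ≤J the other.
    I-regular-J⇔ : ∀ f g → IsRegular l d f → IsRegular l d g → Iset l d f → Iset l d g →
                   JRel l d f g ⇔ (∣ Im l d f ∣ ≡ ∣ Im l d g ∣)
    I-regular-J⇔ f g rf rg If Ig = mk⇔
      (λ (f≤g , g≤f) → ℕP.≤-antisym (JLeq⇒∣Im∣≤ {f} {g} f≤g) (JLeq⇒∣Im∣≤ {g} {f} g≤f))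
      (λ ∣Imf∣≡∣Img∣ → JLeq-inI If (meetsOnce g rg Ig) (ℕP.≤-reflexive ∣Imf∣≡∣Img∣)
                     , JLeq-inI Ig (meetsOnce f rf If) (ℕP.≤-reflexive (sym ∣Imf∣≡∣Img∣)))
      where
      meetsOnce : ∀ h → IsRegular l d h → Iset l d h → MeetsLOnce h
      meetsOnce h rh Ih = regular⇒meetsLOnce h (Iset⇒constOnL Ih) rh

    -- (iii) The regular J-classes inside I are exactly J_0, ..., J_{d+1}: an
    -- idempotent e of such a class lies in J_{|Im e|}, which is its J-class, and
    -- conversely each J_i is the J-class of one of its idempotents.
    I-regularJClasses : ∀ (C : PSet l d) →
      (IsRegularJClass l d C × _⊆W_ l d C (Iset l d)) ⇔ (Σ ℕ λ i → i ≤ suc d × _≐_ l d C (Jset l d i))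
    I-regularJClasses C = mk⇔ toIndex fromIndex
      where
      toIndex : IsRegularJClass l d C × _⊆W_ l d C (Iset l d) → Σ ℕ λ i → i ≤ suc d × _≐_ l d C (Jset l d i)
      toIndex (((f , _ , C≐Jf) , (e , e∈C , ide@(we , _))) , C⊆I) =
        ∣ Im l d e ∣ , ∣Im∣≤1+d e const ,
        ≐-trans C≐Jf (≐-trans (JClassOf-resp (proj₂ (to (C≐Jf e) e∈C))) (≐-sym (Jset≐JClass _ e e∈J)))
        where
        const = Iset⇒constOnL (C⊆I e e∈C)
        e∈J : Jset l d ∣ Im l d e ∣ e
        e∈J = we , meetsLOnce⁻ e (regular⇒meetsLOnce e const (idempotent⇒regular e ide)) , refl
      fromIndex : (Σ ℕ λ i → i ≤ suc d × _≐_ l d C (Jset l d i)) → IsRegularJClass l d C × _⊆W_ l d C (Iset l d)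
      fromIndex (i , i≤1+d , C≐Ji) with idempotentIn i i≤1+d
      ... | e , e∈J@(we , _) , ide =
        ((e , we , ≐-trans C≐Ji (Jset≐JClass i e e∈J)) , (e , from (C≐Ji e) e∈J , ide)) ,
        λ g g∈C → Jset⊆Iset i g (to (C≐Ji g) g∈C)

    -- (iv) J_{d+1} is the unique maximal J-class inside I: every element of I has
    -- at most d + 1 values and so lies ≤J the elements of J_{d+1}.
    I-maximalJClass : IsMaximalJClassIn l d (Iset l d) (Jset l d (suc d))
                    × (∀ C → IsMaximalJClassIn l d (Iset l d) C → _≐_ l d C (Jset l d (suc d)))
    I-maximalJClass = (top-isJClass , top⊆I , maximal) , unique
      where
      top = idempotentIn (suc d) ℕP.≤-refl
      e = proj₁ top
      e∈J : Jset l d (suc d) e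
      e∈J = proj₁ (proj₂ top)
      we = proj₁ e∈J
      top-isJClass : IsJClass l d (Jset l d (suc d))
      top-isJClass = e , we , Jset≐JClass (suc d) e e∈J
      top⊆I : _⊆W_ l d (Jset l d (suc d)) (Iset l d)
      top⊆I = Jset⊆Iset (suc d)
      belowTop : ∀ {g h} → Iset l d g → Jset l d (suc d) h → JLeq l d g h
      belowTop Ig (_ , ∣Imh∩L∣≤1 , ∣Imh∣≡1+d) =
        JLeq-inI Ig (meetsLOnce⁺ _ ∣Imh∩L∣≤1)
                 (ℕP.≤-trans (∣Im∣≤1+d _ (Iset⇒constOnL Ig)) (ℕP.≤-reflexive (sym ∣Imh∣≡1+d)))
      maximal : ∀ C′ → IsJClass l d C′ → _⊆W_ l d C′ (Iset l d) → _≤J_ l d (Jset l d (suc d)) C′ →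
                _≐_ l d C′ (Jset l d (suc d))
      maximal C′ (f′ , wf′ , C′≐Jf′) C′⊆I top≤C′ =
        ≐-trans C′≐Jf′ (≐-trans (JClassOf-resp (e≤f′ , belowTop (C′⊆I f′ f′∈C′) e∈J))
                                (≐-sym (Jset≐JClass (suc d) e e∈J)))
        where
        f′∈C′ = from (C′≐Jf′ f′) (wf′ , JRel-refl f′)
        e≤f′ = top≤C′ e f′ e∈J f′∈C′
      unique : ∀ C → IsMaximalJClassIn l d (Iset l d) C → _≐_ l d C (Jset l d (suc d))
      unique C (_ , C⊆I , C-maximal) =
        ≐-sym (C-maximal (Jset l d (suc d)) top-isJClass top⊆I λ m m′ m∈C m′∈J → belowTop (C⊆I m m∈C) m′∈J)

lemma9p12 : (l d : ℕ) → 3 ≤ l → 1 ≤ d →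
    IsPrimeIdeal l d (Iset l d)
    × (∀ f g → IsRegular l d f → IsRegular l d g → Iset l d f → Iset l d g →
         (JRel l d f g ⇔ (∣ Im l d f ∣ ≡ ∣ Im l d g ∣)))
    × (∀ (C : PSet l d) →
         ((IsRegularJClass l d C × _⊆W_ l d C (Iset l d))
           ⇔ (Σ ℕ λ i → i ≤ suc d × _≐_ l d C (Jset l d i))))
    × (IsMaximalJClassIn l d (Iset l d) (Jset l d (suc d))
       × (∀ C → IsMaximalJClassIn l d (Iset l d) C → _≐_ l d C (Jset l d (suc d))))
lemma9p12 l d l≥3 _ =
  I-prime l d l≥3 , I-regular-J⇔ l d l≥3 , I-regularJClasses l d l≥3 , I-maximalJClass l d l≥3
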